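{- Let $(\Phi,\mathfrak N,\mathfrak T,\mathfrak R,\mathfrak S,\phi_{\mathrm{start}},\Sigma,\mathrm{Lex},\mathrm{Sel})$ be a parameterized local lexing, $D\in\Sigma^*$, and let $x=(r,d,i,j,\rho)$ be a parameterized item with $r=N_{f_{v+1}}\to X_1^{f_1}\cdots X_v^{f_v}$ and $v\ge d+1$. Then for each $\gamma\in\Phi$ there exist $\beta\in\Phi$ and a string $w$ over $\overline{\mathfrak N}\cup\overline{\mathfrak T}$ such that $$\big(N^{\rho_0}_\beta\to(X_1)^{\rho_1}_{\rho_2}\cdots(X_d)^{\rho_{2d-1}}_{\rho_{2d}}\bullet(X_{d+1})^{\rho_{2d+1}}_{\gamma}\,w,\ i,\ j\big)\in\overline x .$$
   Context: $\Phi$ is a non-empty set; $\mathfrak N,\mathfrak T$ disjoint sets of nonterminals and terminals; $\mathfrak S\in\mathfrak N$, $\phi_{\mathrm{start}}\in\Phi$; $\mathfrak R$ a set of parameterized rules $N_{f_{k+1}}\to X_1^{f_1}\cdots X_k^{f_k}$ ($k\ge0$, $N\in\mathfrak N$, $X_i\in\mathfrak N\cup\mathfrak T$, partial $f_i:\Phi^{2i-1}\rightharpoonup\Phi$); $\Sigma,\mathrm{Lex},\mathrm{Sel}$ not needed here. Sequences are indexed from 0; $\mathrm{take}_n$ takes the first $n$ entries. $\langle f_1,\dots,f_u\rangle$ is the set of $\rho\in\Phi^{2u}$ with $f_i$ defined at $(\rho_0,\dots,\rho_{2i-2})$ and $\rho_{2i-1}=f_i(\rho_0,\dots,\rho_{2i-2})$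 for $i=1,\dots,u$. Induced grammar: nonterminals $\overline{\mathfrak N}=(\mathfrak N\times\Phi\times\Phi)\cup\{\top,\bot\}$, terminals $\overline{\mathfrak T}=\mathfrak T\times\Phi\times\Phi$, triples $(X,\alpha,\beta)$ written $X^\alpha_\beta$. For each $r=N_{f_{k+1}}\to X_1^{f_1}\cdots X_k^{f_k}\in\mathfrak R$ the set $\overline r$ consists of (i) rules $N^\alpha_\beta\to(X_1)^{\alpha_1}_{\beta_1}\cdots(X_k)^{\alpha_k}_{\beta_k}$ with $(\alpha,\alpha_1,\beta_1,\dots,\alpha_k,\beta_k,\beta)\in\langle f_1,\dots,f_{k+1}\rangle$, and (ii) rules $N^\alpha_\beta\to(X_1)^{\alpha_1}_{\beta_1}\cdots(X_h)^{\alpha_h}_{\beta_h}\bot$ with $1\le h\le k$, $\beta,\beta_h\in\Phi$, $(\alpha,\alpha_1,\beta_1,\dots,\alpha_h)\in\langle f_1,\dots,f_h\rangle$ and $f_{h+1}$ undefined at $(\alpha,\alpha_1,\beta_1,\dots,\alpha_h,\beta_h)$. A parameterized item is $(r,d,i,j,\rho)$ with $r\in\mathfrak R$ having $k$ right-hand symbols, $0\le d\le k$, $0\le i\le j\le|D|$, $\rho\in\langle f_1,\dots,f_{d+1}\rangle$. An ordinary item $(q,d,i,j)$ ($q=(L\to w)$ an induced rule, $0\le d\le|w|$) is written $(L\to w_1\bullet w_2,i,j)$ with $|w_1|=d$. For $x=(r,d,i,j,\rho)$, $\overline x$ consists of all $(q,d,i,j)$ with $q\in\overline r$ of type (i) and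 $\mathrm{take}_{2(d+1)}(\alpha,\alpha_1,\beta_1,\dots,\alpha_k,\beta_k,\beta)=\rho$, and all $(q,d,i,j)$ with $q\in\overline r$ of type (ii), $d\le h-1$, and $\mathrm{take}_{2(d+1)}(\alpha,\alpha_1,\beta_1,\dots,\alpha_h)=\rho$. -}

module Defs where

open import Data.Nat using (ℕ; zero; suc; _+_; _*_; _∸_; _≤_; _<_)
open import Data.Fin using (Fin; toℕ)
open import Data.List using (List; []; _∷_; _++_; [_]; length; take; drop; head)
open import Data.Vec using (Vec; toList)
open import Data.Maybe using (Maybe; just; nothing)
open import Data.Product using (Σ; ∃; _×_; _,_)
open import Data.Sum using (_⊎_; inj₁; inj₂)
open import Relation.Binary.PropositionalEquality using (_≡_)

-- Partial functions f_{i+1} : Φ^{2i+1} ⇀ Φ  (i = 0,…,k) are  fun i,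
-- represented as functions on lists returning Maybe (nothing = undefined);
-- fun i is only ever applied to lists of length 2i+1.
record Rule (Φ N T : Set) : Set where
  constructor rule
  field
    lhs : N
    k   : ℕ
    rhs : Vec (N ⊎ T) k
    fun : Fin (suc k) → List Φ → Maybe Φ

open Rule public

-- n-th entry of a sequence (sequences indexed from 0)
at : {A : Set} → List A → ℕ → Maybe A
at ρ n = head (drop n ρ)

-- ⟨ f_1 , … , f_u ⟩ ⊆ Φ^{2u}, where f_{i+1} = fs i
Angle : {Φ : Set} {k : ℕ} → (Fin (suc k) → List Φ → Maybe Φ) → ℕ → List Φ → Set
Angle {Φ} {k} fs u ρ =
  length ρ ≡ 2 * u ×
  ((i : Fin (suc k)) → toℕ i < u →
     Σ Φ (λ b → fs i (take (2 * toℕ i + 1) ρ) ≡ just b × at ρ (2 * toℕ i + 1) ≡ just b))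

data NBar (Φ N : Set) : Set where
  node : N → Φ → Φ → NBar Φ N
  top  : NBar Φ N
  bot  : NBar Φ N

TBar : (Φ T : Set) → Set
TBar Φ T = T × Φ × Φ

SymBar : (Φ N T : Set) → Set
SymBar Φ N T = NBar Φ N ⊎ TBar Φ T

ann : {Φ N T : Set} → N ⊎ T → Φ → Φ → SymBar Φ N T
ann (inj₁ n) a b = inj₁ (node n a b)
ann (inj₂ t) a b = inj₂ (t , a , b)

zipPairs : {Φ N T : Set} → List (N ⊎ T) → List Φ → List (SymBar Φ N T)
zipPairs (X ∷ Xs) (a ∷ b ∷ rest) = ann X a b ∷ zipPairs Xs rest
zipPairs _ _ = []

record OItem (Φ N T : Set) : Set where
  constructor item
  field
    ilhs : NBar Φ N
    body : List (SymBar Φ N T)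
    dot  : ℕ
    from : ℕ
    to   : ℕ

mkItem : {Φ N T : Set} → NBar Φ N → List (SymBar Φ N T) → List (SymBar Φ N T) → ℕ → ℕ → OItem Φ N T
mkItem L w₁ w₂ i j = item L (w₁ ++ w₂) (length w₁) i j

data InBar {Φ N T : Set} (r : Rule Φ N T) (d i j : ℕ) (ρ : List Φ) : OItem Φ N T → Set where
  -- type (i) rule, parameters (α, α_1, β_1, …, α_k, β_k, β) = α ∷ τ ++ [ β ]
  type-i : (α : Φ) (τ : List Φ) (β : Φ) →
           Angle (fun r) (suc (k r)) (α ∷ τ ++ [ β ]) →
           take (2 * suc d) (α ∷ τ ++ [ β ]) ≡ ρ →
           InBar r d i j ρ (item (node (lhs r) α β) (zipPairs (toList (rhs r)) τ) d i j)
  -- type (ii) rule, (α, α_1, β_1, …, α_h) = α ∷ τ, β_h, β;  f_{h+1} = fun r h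
  type-ii : (h : Fin (suc (k r))) (α : Φ) (τ : List Φ) (βh β : Φ) →
            1 ≤ toℕ h →
            Angle (fun r) (toℕ h) (α ∷ τ) →
            fun r h (α ∷ τ ++ [ βh ]) ≡ nothing →
            d ≤ toℕ h ∸ 1 →
            take (2 * suc d) (α ∷ τ) ≡ ρ →
            InBar r d i j ρ
              (item (node (lhs r) α β)
                    (zipPairs (take (toℕ h) (toList (rhs r))) (τ ++ [ βh ]) ++ [ inj₁ bot ])
                    d i j)

PItem : {Φ N T Sig : Set} → (Rule Φ N T → Set) → List Sig →
        Rule Φ N T → ℕ → ℕ → ℕ → List Φ → Set
PItem R D r d i j ρ =
  R r × d ≤ k r × i ≤ j × j ≤ length D × Angle (fun r) (suc d) ρ

-- Starting from ρ = (α, α_1, β_1, …, α_{d+1}) ∈ ⟨f_1, …, f_{d+1}⟩, set β_{d+1} = γ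
-- and keep evaluating the next f: each defined value α_{m+1} is appended together
-- with a freely chosen β_{m+1} (γ again).  Either all of f_{d+2}, …, f_{k+1} are
-- defined, and the value of f_{k+1} is the β of a type (i) rule, or some f_{h+1}
-- with h ≥ d + 1 is undefined, which gives a type (ii) rule.  In both cases the
-- parameters up to (X_{d+1})^{α_{d+1}}_γ are those of ρ and γ.
module Submission where

open import Defs
open import Data.Nat using (ℕ; zero; suc; _+_; _*_; _≤_; _<_; _≤‴_; ≤‴-refl; ≤‴-step; s≤s; z≤n)
open import Data.Nat.Properties
open import Data.Fin using (Fin; toℕ; fromℕ<)
open import Data.Fin.Properties using (toℕ-fromℕ<; toℕ-injective)
open import Data.List using (List; []; _∷_; _++_; [_]; length; take; drop)
open import Data.List.Properties using (length-++; ++-assoc; take-all; take-take; ∷-injective)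
open import Data.Vec using (Vec; toList; lookup)
open import Data.Maybe using (Maybe; just; nothing)
open import Data.Product using (Σ; ∃₂; _×_; _,_; proj₁)
open import Data.Sum using (_⊎_; inj₁; inj₂)
open import Relation.Binary.PropositionalEquality using (_≡_; refl; sym; trans; cong; subst; module ≡-Reasoning)

private
  variable
    A : Set

length-snoc : (xs : List A) (y : A) → length (xs ++ [ y ]) ≡ suc (length xs)
length-snoc xs y = trans (length-++ xs) (+-comm (length xs) 1)

snoc-snoc-++ : (xs : List A) (x y : A) (zs : List A) →
               ((xs ++ [ x ]) ++ [ y ]) ++ zs ≡ xs ++ x ∷ y ∷ zs
snoc-snoc-++ xs x y zs = trans (++-assoc (xs ++ [ x ]) [ y ] zs) (++-assoc xs [ x ] (y ∷ zs))

take-++ˡ : ∀ {n} (xs ys : List A) → n ≤ length xs → take n (xs ++ ys) ≡ take n xs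
take-++ˡ {n = zero}  xs       ys _         = refl
take-++ˡ {n = suc n} (x ∷ xs) ys (s≤s n≤) = cong (x ∷_) (take-++ˡ xs ys n≤)

take-length-++ : (xs ys : List A) → take (length xs) (xs ++ ys) ≡ xs
take-length-++ xs ys = trans (take-++ˡ xs ys ≤-refl) (take-all (length xs) xs ≤-refl)

take-prefix : (xs ys zs ws : List A) → xs ++ ys ≡ zs ++ ws → length zs ≤ length xs →
              take (length zs) xs ≡ zs
take-prefix xs ys zs ws eq le = begin
  take (length zs) xs         ≡⟨ take-++ˡ xs ys le ⟨
  take (length zs) (xs ++ ys) ≡⟨ cong (take (length zs)) eq ⟩
  take (length zs) (zs ++ ws) ≡⟨ take-length-++ zs ws ⟩
  zs                          ∎
  where open ≡-Reasoning

at-++ˡ : ∀ {n} (xs ys : List A) → n < length xs → at (xs ++ ys) n ≡ at xs n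
at-++ˡ {n = zero}  (x ∷ xs) ys _         = refl
at-++ˡ {n = suc n} (x ∷ xs) ys (s≤s n<) = at-++ˡ xs ys n<

at-length : (xs : List A) (y : A) (ys : List A) → at (xs ++ y ∷ ys) (length xs) ≡ just y
at-length []       y ys = refl
at-length (x ∷ xs) y ys = at-length xs y ys

at-take : ∀ {n m} (xs : List A) → n < m → at (take m xs) n ≡ at xs n
at-take {n = zero}  {suc m} []       _         = refl
at-take {n = zero}  {suc m} (x ∷ xs) _         = refl
at-take {n = suc n} {suc m} []       _         = refl
at-take {n = suc n} {suc m} (x ∷ xs) (s≤s n<) = at-take xs n<

at-toList : ∀ {n d} (v : Vec A n) (d<n : d < n) → at (toList v) d ≡ just (lookup v (fromℕ< d<n))
at-toList {d = zero}  (x Vec.∷ v) _          = refl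
at-toList {d = suc d} (x Vec.∷ v) (s≤s d<n) = at-toList v d<n

2*i+1<2*m : ∀ {i m} → i < m → 2 * i + 1 < 2 * m
2*i+1<2*m {i} {m} i<m = begin-strict
  2 * i + 1   ≡⟨ +-comm (2 * i) 1 ⟩
  suc (2 * i) <⟨ n<1+n _ ⟩
  2 + 2 * i   ≡⟨ *-suc 2 i ⟨
  2 * suc i   ≤⟨ *-monoʳ-≤ 2 i<m ⟩
  2 * m       ∎
  where open ≤-Reasoning

module _ {Φ N T : Set} where

  zipPairs-at : ∀ d (Xs : List (N ⊎ T)) {X} (ps : List Φ) a c qs →
                length ps ≡ 2 * d → at Xs d ≡ just X →
                zipPairs Xs (ps ++ a ∷ c ∷ qs)
                  ≡ zipPairs (take d Xs) ps ++ ann X a c ∷ zipPairs (drop (suc d) Xs) qs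
  zipPairs-at zero    (X ∷ Xs) [] a c qs _   refl = refl
  zipPairs-at (suc d) (Y ∷ Xs) ps a c qs len at≡ with ps | trans len (*-suc 2 d)
  ... | p ∷ q ∷ ps′ | len′ =
    cong (ann Y p q ∷_) (zipPairs-at d Xs ps′ a c qs (suc-injective (suc-injective len′)) at≡)

  length-zipPairs-take : ∀ d (Xs : List (N ⊎ T)) {X} (ps : List Φ) →
                         length ps ≡ 2 * d → at Xs d ≡ just X →
                         length (zipPairs (take d Xs) ps) ≡ d
  length-zipPairs-take zero    Xs       ps _   _   = refl
  length-zipPairs-take (suc d) (Y ∷ Xs) ps len at≡ with ps | trans len (*-suc 2 d)
  ... | p ∷ q ∷ ps′ | len′ =
    cong suc (length-zipPairs-take d Xs ps′ (suc-injective (suc-injective len′)) at≡)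

  item≡mkItem : ∀ {L : NBar Φ N} {body} (w₁ w₂ : List (SymBar Φ N T)) {d i j} →
                length w₁ ≡ d → body ≡ w₁ ++ w₂ → item L body d i j ≡ mkItem L w₁ w₂ i j
  item≡mkItem w₁ w₂ refl refl = refl

module Greedy {Φ : Set} {k : ℕ} (fs : Fin (suc k) → List Φ → Maybe Φ) where

  -- Angle fs u ρ is, definitionally, length ρ ≡ 2 * u × Consistent u ρ.
  Consistent : ℕ → List Φ → Set
  Consistent u ρ = (i : Fin (suc k)) → toℕ i < u →
    Σ Φ (λ b → fs i (take (2 * toℕ i + 1) ρ) ≡ just b × at ρ (2 * toℕ i + 1) ≡ just b)

  Consistent-++ : ∀ {m} P E → length P ≡ 2 * m → Consistent m P → Consistent m (P ++ E)
  Consistent-++ {m} P E lenP consP i i<m with consP i i<m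
  ... | c , fi≡c , at≡c = c , trans (cong (fs i) (take-++ˡ P E (<⇒≤ 2i+1<))) fi≡c
                            , trans (at-++ˡ P E 2i+1<) at≡c
    where 2i+1< = subst (2 * toℕ i + 1 <_) (sym lenP) (2*i+1<2*m i<m)

  Angle-extend : ∀ {m P β b} (h : Fin (suc k)) → toℕ h ≡ m → Angle fs m P →
                 fs h (P ++ [ β ]) ≡ just b → Angle fs (suc m) ((P ++ [ β ]) ++ [ b ])
  Angle-extend {P = P} {β} {b} h refl (lenP , consP) fh≡b = length′ , consistent′
    where
      open ≡-Reasoning
      m = toℕ h
      Pβ = P ++ [ β ]

      length′ : length (Pβ ++ [ b ]) ≡ 2 * suc m
      length′ = begin
        length (Pβ ++ [ b ])  ≡⟨ length-snoc Pβ b ⟩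
        suc (length Pβ)       ≡⟨ cong suc (length-snoc P β) ⟩
        suc (suc (length P))  ≡⟨ cong (λ n → suc (suc n)) lenP ⟩
        2 + 2 * m             ≡⟨ *-suc 2 m ⟨
        2 * suc m             ∎

      index : 2 * m + 1 ≡ length Pβ
      index = begin
        2 * m + 1      ≡⟨ +-comm (2 * m) 1 ⟩
        suc (2 * m)    ≡⟨ cong suc lenP ⟨
        suc (length P) ≡⟨ length-snoc P β ⟨
        length Pβ      ∎

      consistent′ : Consistent (suc m) (Pβ ++ [ b ])
      consistent′ i i<1+m with m≤n⇒m<n∨m≡n (≤-pred i<1+m)
      ... | inj₁ i<m  =
        subst (Consistent m) (sym (++-assoc P [ β ] [ b ])) (Consistent-++ P (β ∷ [ b ]) lenP consP) i i<m
      ... | inj₂ i≡m with toℕ-injective i≡m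
      ... | refl =
        b , trans (cong (λ n → fs h (take n (Pβ ++ [ b ]))) index)
                  (trans (cong (fs h) (take-length-++ Pβ [ b ])) fh≡b)
          , trans (cong (at (Pβ ++ [ b ])) index) (at-length Pβ b [])

  -- All entries β_m, β_{m+1}, … appended after P ∈ ⟨f_1, …, f_m⟩ are chosen equal to β;
  -- σ is what follows the first of them.
  data Completion (m : ℕ) (P : List Φ) (β : Φ) : Set where
    total : (σ : List Φ) (b : Φ) → Angle fs (suc k) ((P ++ β ∷ σ) ++ [ b ]) → Completion m P β
    stuck : (h : Fin (suc k)) (Q σ : List Φ) → m ≤ toℕ h → Angle fs (toℕ h) Q →
            fs h (Q ++ [ β ]) ≡ nothing → Q ++ [ β ] ≡ P ++ β ∷ σ → Completion m P β

  Completion-unstep : ∀ {m P β b} → Completion (suc m) ((P ++ [ β ]) ++ [ b ]) β → Completion m P β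
  Completion-unstep {P = P} {β} {b} (total σ b′ A) =
    total (b ∷ β ∷ σ) b′
      (subst (λ L → Angle fs (suc k) (L ++ [ b′ ])) (snoc-snoc-++ P β b (β ∷ σ)) A)
  Completion-unstep {P = P} {β} {b} (stuck h Q σ 1+m≤h A undefined Qβ≡) =
    stuck h Q (b ∷ β ∷ σ) (≤-trans (n≤1+n _) 1+m≤h) A undefined
      (trans Qβ≡ (snoc-snoc-++ P β b (β ∷ σ)))

  complete : ∀ {m} P β → m ≤‴ k → Angle fs m P → Completion m P β
  complete {m} P β m≤‴k A with fs (fromℕ< (s≤s (≤‴⇒≤ m≤‴k))) (P ++ [ β ]) in fh≡
  ... | nothing =
    stuck _ P [] (≤-reflexive (sym h≡m)) (subst (λ u → Angle fs u P) (sym h≡m) A) fh≡ refl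
    where h≡m = toℕ-fromℕ< (s≤s (≤‴⇒≤ m≤‴k))
  ... | just b with m≤‴k
  ...   | ≤‴-refl      = total [] b (Angle-extend _ (toℕ-fromℕ< _) A fh≡)
  ...   | ≤‴-step m<‴k =
    Completion-unstep (complete _ β m<‴k (Angle-extend _ (toℕ-fromℕ< _) A fh≡))

open Greedy using (total; stuck; complete)

module DottedItem {Φ N T : Set} (r : Rule Φ N T) {d i j : ℕ} {α a γ : Φ} {τ : List Φ}
                  (1+d≤k : suc d ≤ k r) (lenρ : length (α ∷ τ ++ [ a ]) ≡ 2 * suc d) where

  private
    ρ = α ∷ τ ++ [ a ]
    Xs = toList (rhs r)
    X = lookup (rhs r) (fromℕ< 1+d≤k)

    at-Xs : at Xs d ≡ just X
    at-Xs = at-toList (rhs r) 1+d≤k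

    lenτ : length τ ≡ 2 * d
    lenτ = suc-injective (suc-injective (begin
      suc (suc (length τ)) ≡⟨ cong suc (length-snoc τ a) ⟨
      length ρ             ≡⟨ lenρ ⟩
      2 * suc d            ≡⟨ *-suc 2 d ⟩
      suc (suc (2 * d))    ∎))
      where open ≡-Reasoning

    prefix = zipPairs {Φ} {N} {T} (take d Xs) τ

    length-prefix : length prefix ≡ d
    length-prefix = length-zipPairs-take d Xs τ lenτ at-Xs

  Dotted : Set
  Dotted = ∃₂ λ (β : Φ) (w : List (SymBar Φ N T)) →
    InBar r d i j ρ (mkItem (node (lhs r) α β) prefix (ann X a γ ∷ w) i j)

  fromTotal : (σ : List Φ) (b : Φ) → Angle (fun r) (suc (k r)) ((ρ ++ γ ∷ σ) ++ [ b ]) → Dotted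
  fromTotal σ b A = b , zipPairs (drop (suc d) Xs) σ ,
    subst (InBar r d i j ρ) (item≡mkItem prefix _ length-prefix body) (type-i α τ′ b A takes-ρ)
    where
      τ′ = (τ ++ [ a ]) ++ γ ∷ σ

      body : zipPairs Xs τ′ ≡ prefix ++ ann X a γ ∷ zipPairs (drop (suc d) Xs) σ
      body = trans (cong (zipPairs Xs) (++-assoc τ [ a ] (γ ∷ σ)))
                   (zipPairs-at d Xs τ a γ σ lenτ at-Xs)

      takes-ρ : take (2 * suc d) (α ∷ τ′ ++ [ b ]) ≡ ρ
      takes-ρ = subst (λ n → take n (α ∷ τ′ ++ [ b ]) ≡ ρ) lenρ
                  (trans (cong (take (length ρ)) (++-assoc ρ (γ ∷ σ) [ b ]))
                         (take-length-++ ρ (γ ∷ σ ++ [ b ])))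

  fromStuck : (h : Fin (suc (k r))) (Q σ : List Φ) → suc d ≤ toℕ h → Angle (fun r) (toℕ h) Q →
              fun r h (Q ++ [ γ ]) ≡ nothing → Q ++ [ γ ] ≡ ρ ++ γ ∷ σ → Dotted
  fromStuck h [] σ 1+d≤h (lenQ , _) _ _ with ≤-trans (*-monoʳ-≤ 2 1+d≤h) (≤-reflexive (sym lenQ))
  ... | ()
  fromStuck h (q ∷ τ′) σ 1+d≤h A undefined Qγ≡ with ∷-injective Qγ≡
  ... | refl , τ′γ≡ = γ , rest ,
    subst (InBar r d i j ρ) (item≡mkItem prefix _ length-prefix body)
      (type-ii h α τ′ γ γ (≤-trans (s≤s z≤n) 1+d≤h) A undefined (∸-monoˡ-≤ 1 1+d≤h)
               takes-ρ)
    where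
      Ys = take (toℕ h) Xs
      ⊥sym = inj₁ bot
      rest = zipPairs (drop (suc d) Ys) σ ++ [ ⊥sym ]

      take-d-Ys : take d Ys ≡ take d Xs
      take-d-Ys = trans (take-take d (toℕ h) Xs)
                        (cong (λ n → take n Xs) (m≤n⇒m⊓n≡m (≤-trans (n≤1+n d) 1+d≤h)))

      body : zipPairs Ys (τ′ ++ [ γ ]) ++ [ ⊥sym ] ≡ prefix ++ ann X a γ ∷ rest
      body = begin
        zipPairs Ys (τ′ ++ [ γ ]) ++ [ ⊥sym ]
          ≡⟨ cong (λ ps → zipPairs Ys ps ++ [ ⊥sym ]) (trans τ′γ≡ (++-assoc τ [ a ] (γ ∷ σ))) ⟩
        zipPairs Ys (τ ++ a ∷ γ ∷ σ) ++ [ ⊥sym ]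
          ≡⟨ cong (_++ [ ⊥sym ]) (zipPairs-at d Ys τ a γ σ lenτ (trans (at-take Xs 1+d≤h) at-Xs)) ⟩
        (zipPairs (take d Ys) τ ++ ann X a γ ∷ zipPairs (drop (suc d) Ys) σ) ++ [ ⊥sym ]
          ≡⟨ ++-assoc (zipPairs (take d Ys) τ) _ _ ⟩
        zipPairs (take d Ys) τ ++ ann X a γ ∷ rest
          ≡⟨ cong (λ Zs → zipPairs Zs τ ++ ann X a γ ∷ rest) take-d-Ys ⟩
        prefix ++ ann X a γ ∷ rest
          ∎
        where open ≡-Reasoning

      length-ρ≤ : length ρ ≤ length (α ∷ τ′)
      length-ρ≤ = begin
        length ρ             ≡⟨ lenρ ⟩
        2 * suc d            ≤⟨ *-monoʳ-≤ 2 1+d≤h ⟩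
        2 * toℕ h            ≡⟨ proj₁ A ⟨
        length (α ∷ τ′)      ∎
        where open ≤-Reasoning

      takes-ρ : take (2 * suc d) (α ∷ τ′) ≡ ρ
      takes-ρ = subst (λ n → take n (α ∷ τ′) ≡ ρ) lenρ
                  (take-prefix (α ∷ τ′) [ γ ] ρ (γ ∷ σ) Qγ≡ length-ρ≤)

open DottedItem using (fromTotal; fromStuck)

theorem4 : {Φ N T Sig : Set} (S : N) (φstart : Φ) (R : Rule Φ N T → Set) (D : List Sig)
           (r : Rule Φ N T) (d i j : ℕ) (α : Φ) (τ : List Φ) (a : Φ) →
           PItem R D r d i j (α ∷ τ ++ [ a ]) →
           (v≥d+1 : suc d ≤ k r) →
           (γ : Φ) →
           ∃₂ λ (β : Φ) (w : List (SymBar Φ N T)) →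
             InBar r d i j (α ∷ τ ++ [ a ])
               (mkItem (node (lhs r) α β)
                       (zipPairs (take d (toList (rhs r))) τ)
                       (ann (lookup (rhs r) (fromℕ< v≥d+1)) a γ ∷ w)
                       i j)
theorem4 _ _ _ _ r d i j α τ a (_ , _ , _ , _ , Aρ) v≥d+1 γ
  with complete (fun r) (α ∷ τ ++ [ a ]) γ (≤⇒≤‴ v≥d+1) Aρ
... | total σ b A = fromTotal r v≥d+1 (proj₁ Aρ) σ b A
... | stuck h Q σ 1+d≤h A undefined Qγ≡ =
  fromStuck r v≥d+1 (proj₁ Aρ) h Q σ 1+d≤h A undefined Qγ≡
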